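{- Let $T$ be a singular tree, and let $CFV_R$ be the set of vertices of $T$ that are neither core vertices nor adjacent to a core vertex. Then the subgraph of $T$ induced by $CFV_R$ has a perfect matching (the empty graph being regarded as having the empty perfect matching).
   Context: For the $\{0,1\}$-adjacency matrix $\mathbf{A}$ of $T$, $T$ is singular if $\ker\mathbf{A}\neq\{\mathbf{0}\}$, and a vertex $v$ is a core vertex if some $\mathbf{x}\in\ker\mathbf{A}$ has $x_v\neq0$. In a singular tree the core vertices form an independent set, so the vertex set is partitioned into the core vertices $CV$, their neighbours $N(CV)$, and $CFV_R$ (the core-labelling). -}

module Defs where

open import Data.Nat using (ℕ; zero; suc)
open import Data.Fin using (Fin; zero; suc)
open import Data.Bool using (Bool; true; false; if_then_else_)
open import Data.List using (List; []; _∷_)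
open import Data.List.Relation.Unary.Unique.Propositional using (Unique)
open import Data.Product using (Σ; ∃; _×_; _,_)
open import Data.Rational using (ℚ; 0ℚ; _+_; _*_)
open import Relation.Binary.PropositionalEquality using (_≡_; _≢_)
open import Relation.Nullary using (¬_)

record Graph (n : ℕ) : Set where
  field
    adj   : Fin n → Fin n → Bool
    sym   : ∀ u v → adj u v ≡ adj v u
    irrfl : ∀ v → adj v v ≡ false

module _ {n : ℕ} (G : Graph n) where
  open Graph G

  Adj : Fin n → Fin n → Set
  Adj u v = adj u v ≡ true

  data Walk : Fin n → Fin n → List (Fin n) → Set where
    here : ∀ {v} → Walk v v (v ∷ [])
    step : ∀ {u w v p} → Adj u w → Walk w v p → Walk u v (u ∷ p)

  IsPath : Fin n → Fin n → List (Fin n) → Set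
  IsPath u v p = Walk u v p × Unique p

  IsTree : Set
  IsTree = ∀ u v → Σ (List (Fin n)) λ p → IsPath u v p × (∀ q → IsPath u v q → q ≡ p)

  A : Fin n → Fin n → ℚ
  A u v = if adj u v then Data.Rational.1ℚ else 0ℚ

sumFin : ∀ {n} → (Fin n → ℚ) → ℚ
sumFin {zero}  f = 0ℚ
sumFin {suc n} f = f zero + sumFin (λ i → f (suc i))

module _ {n : ℕ} (G : Graph n) where

  InKernel : (Fin n → ℚ) → Set
  InKernel x = ∀ u → sumFin (λ v → A G u v * x v) ≡ 0ℚ

  Singular : Set
  Singular = Σ (Fin n → ℚ) λ x → InKernel x × ∃ λ v → x v ≢ 0ℚ

  CoreVertex : Fin n → Set
  CoreVertex v = Σ (Fin n → ℚ) λ x → InKernel x × x v ≢ 0ℚ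

  CFVR : Fin n → Set
  CFVR v = ¬ CoreVertex v × ¬ (∃ λ u → Adj G u v × CoreVertex u)

  -- a perfect matching of the subgraph induced by a vertex set S, given as
  -- a partner function m: every vertex of S is matched to an adjacent vertex
  -- of S, and the matching is an involution on S
  HasPerfectMatchingInduced : (Fin n → Set) → Set
  HasPerfectMatchingInduced S =
    Σ (Fin n → Fin n) λ m → ∀ v → S v → S (m v) × Adj G v (m v) × m (m v) ≡ v

-- The statement holds for every induced subforest T[S] (with CFV_R taken in
-- T[S]); induct on S.  A vertex ℓ of maximal depth in T[S] has at most one
-- neighbour in T[S].  If it has none, the indicator of ℓ is a kernel vector, so
-- ℓ is core and deleting it leaves CFV_R unchanged.  If it is a pendant vertex
-- with neighbour p, the row of ℓ forces every kernel vector to vanish at p, and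
-- kernel vectors of T[S] and T[S - ℓ - p] correspond by restriction and by
-- extension (the value at ℓ balances the row of p), so CFV_R is unchanged away
-- from ℓ and p.  Moreover ℓ ∈ CFV_R iff p ∈ CFV_R: were a neighbour w ≠ ℓ of p
-- core via x, copying x on the branch at p through w and putting -x_w at ℓ
-- would make ℓ core.  So the edge ℓp extends the matching of T[S - ℓ - p].
module Submission where

open import Defs
open import Algebra.Bundles using (CommutativeMonoid)
open import Data.Bool using (Bool; true; false; if_then_else_)
open import Data.Bool.Properties using () renaming (_≟_ to _≟ᵇ_)
open import Data.Empty using (⊥; ⊥-elim)
open import Data.Fin using (Fin; zero; suc)
open import Data.Fin.Properties using (_≟_; any?; suc-injective)
open import Data.Fin.Subset using (Subset; _∈_; _∉_; _⊆_; _⊂_; _-_; ⊤; Empty; inside; outside)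
open import Data.Fin.Subset.Induction using (⊂-wellFounded)
open import Data.Fin.Subset.Properties
  using (_∈?_; ∈⊤; nonempty?; p─q⊆p; x∈p∧x≢y⇒x∈p-y; x∈p⇒p-x⊂p; ⊂-trans)
open import Data.List using (List; []; _∷_; _++_; length)
open import Data.List.Membership.Propositional using () renaming (_∈_ to _∈ₗ_; _∉_ to _∉ₗ_)
open import Data.List.Membership.Propositional.Properties using (∈-++⁺ʳ)
import Data.List.Membership.DecPropositional as DecMembership
open import Data.List.Properties using (length-++; ∷-injectiveˡ; ∷-injectiveʳ)
open import Data.List.Relation.Unary.All.Properties using (¬Any⇒All¬)
open import Data.List.Relation.Unary.All using ([]; _∷_)
open import Data.List.Relation.Unary.AllPairs using ([]; _∷_)
open import Data.List.Relation.Unary.Any using (here; there)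
open import Data.List.Relation.Unary.Unique.Propositional using (Unique)
open import Data.Nat using (ℕ; zero; suc; _≤_; _<_; s≤s; _≤?_)
open import Data.Nat.Properties using (≤-refl; ≤-trans; ≰⇒≥; <-irrefl; <-≤-trans; m≤n+m)
open import Data.Product using (Σ; ∃; ∃₂; _×_; _,_; proj₁; proj₂)
open import Data.Rational using (ℚ; 0ℚ; 1ℚ; _+_; _*_; -_)
open import Data.Rational.Properties
  using (+-0-commutativeMonoid; +-identityˡ; +-identityʳ; +-inverseˡ; +-inverseʳ;
         *-zeroˡ; *-zeroʳ; *-identityˡ; *-distribˡ-+; neg-injective)
open import Data.Sum using (_⊎_; inj₁; inj₂)
open import Data.Vec using ([]; _∷_; here; there)
open import Function using (_∘_)
open import Function.Bundles using (_⇔_; mk⇔; Equivalence)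
open import Induction.WellFounded using (Acc; acc)
open import Relation.Binary.PropositionalEquality
  using (_≡_; _≢_; refl; sym; trans; cong; cong₂; subst; module ≡-Reasoning)
open import Relation.Nullary using (¬_; Dec; yes; no; does)
open import Relation.Nullary.Decidable using (_×-dec_)
open import Relation.Unary using (Decidable)

open import Algebra.Properties.CommutativeSemigroup
  (CommutativeMonoid.commutativeSemigroup +-0-commutativeMonoid) using (interchange)
open Equivalence using (to; from)

sumFin-cong : ∀ {n} {f g : Fin n → ℚ} → (∀ i → f i ≡ g i) → sumFin f ≡ sumFin g
sumFin-cong {zero}  f≡g = refl
sumFin-cong {suc n} f≡g = cong₂ _+_ (f≡g zero) (sumFin-cong (f≡g ∘ suc))

sumFin-zero : ∀ {n} {f : Fin n → ℚ} → (∀ i → f i ≡ 0ℚ) → sumFin f ≡ 0ℚ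
sumFin-zero {n} f≡0 = trans (sumFin-cong f≡0) (sumFin-const0 n)
  where
  sumFin-const0 : ∀ n → sumFin {n} (λ _ → 0ℚ) ≡ 0ℚ
  sumFin-const0 zero    = refl
  sumFin-const0 (suc n) = trans (+-identityˡ _) (sumFin-const0 n)

sumFin-single : ∀ {n} {f : Fin n → ℚ} k → (∀ i → i ≢ k → f i ≡ 0ℚ) → sumFin f ≡ f k
sumFin-single {suc n} {f} zero    f≡0 =
  trans (cong (f zero +_) (sumFin-zero (λ i → f≡0 (suc i) λ ()))) (+-identityʳ (f zero))
sumFin-single {suc n} {f} (suc k) f≡0 =
  trans (cong₂ _+_ (f≡0 zero λ ()) (sumFin-single k λ i i≢k → f≡0 (suc i) (i≢k ∘ suc-injective)))
        (+-identityˡ (f (suc k)))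

sumFin-+ : ∀ {n} (f g : Fin n → ℚ) → sumFin (λ i → f i + g i) ≡ sumFin f + sumFin g
sumFin-+ {zero}  f g = refl
sumFin-+ {suc n} f g =
  trans (cong (f zero + g zero +_) (sumFin-+ (f ∘ suc) (g ∘ suc)))
        (interchange (f zero) (g zero) (sumFin (f ∘ suc)) (sumFin (g ∘ suc)))

restrict : ∀ {n} {P : Fin n → Set} → Decidable P → (Fin n → ℚ) → Fin n → ℚ
restrict P? x v = if does (P? v) then x v else 0ℚ

module _ {n} {P : Fin n → Set} (P? : Decidable P) (x : Fin n → ℚ) where

  restrict-∈ : ∀ {v} → P v → restrict P? x v ≡ x v
  restrict-∈ {v} Pv with P? v
  ... | yes _  = refl
  ... | no ¬Pv = ⊥-elim (¬Pv Pv)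

  restrict-∉ : ∀ {v} → ¬ P v → restrict P? x v ≡ 0ℚ
  restrict-∉ {v} ¬Pv with P? v
  ... | yes Pv = ⊥-elim (¬Pv Pv)
  ... | no _   = refl

  restrict-zero : ∀ {v} → x v ≡ 0ℚ → restrict P? x v ≡ 0ℚ
  restrict-zero {v} xv≡0 with P? v
  ... | yes _ = xv≡0
  ... | no _  = refl

δ : ∀ {n} → Fin n → ℚ → Fin n → ℚ
δ k c = restrict (_≟ k) (λ _ → c)

x∉p-x : ∀ {n} (p : Subset n) x → x ∉ p - x
x∉p-x (_ ∷ p) zero    ()
x∉p-x (_ ∷ p) (suc x) (there x∈p-x) = x∉p-x p x x∈p-x

x∈p-y⇒x≢y : ∀ {n} {p : Subset n} {x y} → x ∈ p - y → x ≢ y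
x∈p-y⇒x≢y {p = p} {x} x∈p-x refl = x∉p-x p x x∈p-x

x∈p-y⇒x∈p : ∀ {n} {p : Subset n} {x y} → x ∈ p - y → x ∈ p
x∈p-y⇒x∈p {p = p} = p─q⊆p p _

deepest : ∀ {n} (d : Fin n → ℕ) (S : Subset n) →
  Empty S ⊎ ∃ λ ℓ → ℓ ∈ S × ∀ {y} → y ∈ S → d y ≤ d ℓ
deepest d [] = inj₁ λ ()
deepest d (s ∷ S) with deepest (d ∘ suc) S
deepest d (outside ∷ S) | inj₁ empty = inj₁ λ { (suc y , there y∈S) → empty (y , y∈S) }
deepest d (inside ∷ S)  | inj₁ empty =
  inj₂ (zero , here , λ { here → ≤-refl ; (there y∈S) → ⊥-elim (empty (_ , y∈S)) })
deepest d (outside ∷ S) | inj₂ (ℓ , ℓ∈S , max) = inj₂ (suc ℓ , there ℓ∈S , λ { (there y∈S) → max y∈S })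
deepest d (inside ∷ S)  | inj₂ (ℓ , ℓ∈S , max) with d (suc ℓ) ≤? d zero
... | yes ℓ≤0 = inj₂ (zero , here , λ { here → ≤-refl ; (there y∈S) → ≤-trans (max y∈S) ℓ≤0 })
... | no ℓ≰0  = inj₂ (suc ℓ , there ℓ∈S , λ { here → ≰⇒≥ ℓ≰0 ; (there y∈S) → max y∈S })

Unique-++⁻ʳ : ∀ {A : Set} (xs : List A) {ys} → Unique (xs ++ ys) → Unique ys
Unique-++⁻ʳ []       ys-distinct           = ys-distinct
Unique-++⁻ʳ (_ ∷ xs) (_ ∷ xs++ys-distinct) = Unique-++⁻ʳ xs xs++ys-distinct

xs++a∷b∷zs≢[c] : ∀ {A : Set} (xs : List A) {a b c zs} → xs ++ a ∷ b ∷ zs ≢ c ∷ []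
xs++a∷b∷zs≢[c] []          ()
xs++a∷b∷zs≢[c] (_ ∷ [])    ()
xs++a∷b∷zs≢[c] (_ ∷ _ ∷ _) ()

penultimate-∈ : ∀ {A : Set} (xs ys : List A) {a b w p zs} →
  xs ++ a ∷ b ∷ zs ≡ ys ++ w ∷ p ∷ [] → w ∈ₗ a ∷ b ∷ zs
penultimate-∈ []       ys       e = subst (_ ∈ₗ_) (sym e) (∈-++⁺ʳ ys (here refl))
penultimate-∈ (_ ∷ xs) []       e = ⊥-elim (xs++a∷b∷zs≢[c] xs (∷-injectiveʳ e))
penultimate-∈ (_ ∷ xs) (_ ∷ ys) e = penultimate-∈ xs ys (∷-injectiveʳ e)

module _ {n : ℕ} (T : Graph n) where

  open Graph T using (adj; irrfl)

  HasPerfectMatching : (Fin n → Set) → Set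
  HasPerfectMatching = HasPerfectMatchingInduced T

  adj-irrefl : ∀ {u v} → Adj T u v → u ≢ v
  adj-irrefl {u} u~u refl with () ← trans (sym u~u) (irrfl u)

  adj-sym : ∀ {u v} → Adj T u v → Adj T v u
  adj-sym {u} {v} u~v = trans (Graph.sym T v u) u~v

  adj? : ∀ u v → Dec (Adj T u v)
  adj? u v = adj u v ≟ᵇ true

  walk-starts : ∀ {u v q} → Walk T u v q → ∃ λ t → q ≡ u ∷ t
  walk-starts here       = _ , refl
  walk-starts (step _ _) = _ , refl

  walk-trivial : ∀ {u v} → Walk T u v (u ∷ []) → u ≡ v
  walk-trivial here = refl

  walk-from : ∀ {u v q y} → Walk T u v q → y ∈ₗ q →
    ∃₂ λ pre q' → q ≡ pre ++ q' × Walk T y v q'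
  walk-from here         (here refl) = [] , _ , refl , here
  walk-from (step e w)   (here refl) = [] , _ , refl , step e w
  walk-from {u} (step _ w) (there y∈q) with pre , q' , e , w' ← walk-from w y∈q =
    u ∷ pre , q' , cong (u ∷_) e , w'

  A*-cong : ∀ {u v q r} → (Adj T u v → q ≡ r) → A T u v * q ≡ A T u v * r
  A*-cong {u} {v} {q} {r} q≡r = by-entry (adj u v) refl
    where
    by-entry : (b : Bool) → adj u v ≡ b → (if b then 1ℚ else 0ℚ) * q ≡ (if b then 1ℚ else 0ℚ) * r
    by-entry true  u~v = cong (1ℚ *_) (q≡r u~v)
    by-entry false _   = trans (*-zeroˡ q) (sym (*-zeroˡ r))

  A*≡0 : ∀ {u v q} → (Adj T u v → q ≡ 0ℚ) → A T u v * q ≡ 0ℚ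
  A*≡0 {u} {v} q≡0 = trans (A*-cong q≡0) (*-zeroʳ (A T u v))

  A*-adjacent : ∀ {u v} q → Adj T u v → A T u v * q ≡ q
  A*-adjacent q u~v rewrite u~v = *-identityˡ q

  Ax : (Fin n → ℚ) → Fin n → ℚ
  Ax x u = sumFin (λ v → A T u v * x v)

  Ax-cong : ∀ {x y u} → (∀ v → Adj T u v → x v ≡ y v) → Ax x u ≡ Ax y u
  Ax-cong x≡y = sumFin-cong λ v → A*-cong (x≡y v)

  Ax-zero : ∀ {x u} → (∀ v → Adj T u v → x v ≡ 0ℚ) → Ax x u ≡ 0ℚ
  Ax-zero x≡0 = sumFin-zero λ v → A*≡0 (x≡0 v)

  Ax-single : ∀ {x u} k → (∀ v → Adj T u v → v ≢ k → x v ≡ 0ℚ) → Ax x u ≡ A T u k * x k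
  Ax-single k x≡0 = sumFin-single k λ v v≢k → A*≡0 λ u~v → x≡0 v u~v v≢k

  Ax-+ : ∀ x y u → Ax (λ v → x v + y v) u ≡ Ax x u + Ax y u
  Ax-+ x y u = trans (sumFin-cong λ v → *-distribˡ-+ (A T u v) (x v) (y v))
                     (sumFin-+ (λ v → A T u v * x v) (λ v → A T u v * y v))

  Ax-δ : ∀ k c u → Ax (δ k c) u ≡ A T u k * c
  Ax-δ k c u = trans (Ax-single k λ v _ v≢k → restrict-∉ (_≟ k) _ v≢k)
                     (cong (A T u k *_) (restrict-∈ (_≟ k) _ refl))

  -- kernel vectors of the induced subgraph T[S], extended by zero to all vertices
  record InKernelOn (S : Subset n) (x : Fin n → ℚ) : Set where
    field
      outside-zero : ∀ {v} → v ∉ S → x v ≡ 0ℚ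
      row-zero     : ∀ {u} → u ∈ S → Ax x u ≡ 0ℚ
  open InKernelOn

  CoreOn : Subset n → Fin n → Set
  CoreOn S v = Σ (Fin n → ℚ) λ x → InKernelOn S x × x v ≢ 0ℚ

  record CFVROn (S : Subset n) (v : Fin n) : Set where
    field
      member            : v ∈ S
      not-core          : ¬ CoreOn S v
      no-core-neighbour : ∀ {u} → u ∈ S → Adj T u v → ¬ CoreOn S u
  open CFVROn

  core-∈ : ∀ {S v} → CoreOn S v → v ∈ S
  core-∈ {S} {v} (x , x∈ker , xv≢0) with v ∈? S
  ... | yes v∈S = v∈S
  ... | no v∉S  = ⊥-elim (xv≢0 (outside-zero x∈ker v∉S))

  core-restrict : ∀ {S S'} → S' ⊆ S →
    (∀ {x} → InKernelOn S x → ∀ {u v} → u ∈ S' → v ∉ S' → Adj T u v → x v ≡ 0ℚ) →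
    ∀ {v} → v ∈ S' → CoreOn S v → CoreOn S' v
  core-restrict {S} {S'} S'⊆S leaving-zero v∈S' (x , x∈ker , xv≢0) =
    restrict (_∈? S') x , x'∈ker , xv≢0 ∘ trans (sym (restrict-∈ (_∈? S') x v∈S'))
    where
    agree : ∀ {u} → u ∈ S' → ∀ v → Adj T u v → restrict (_∈? S') x v ≡ x v
    agree u∈S' v u~v with v ∈? S'
    ... | yes _   = refl
    ... | no v∉S' = sym (leaving-zero x∈ker u∈S' v∉S' u~v)
    x'∈ker : InKernelOn S' (restrict (_∈? S') x)
    x'∈ker = record
      { outside-zero = restrict-∉ (_∈? S') x
      ; row-zero     = λ u∈S' → trans (Ax-cong (agree u∈S')) (row-zero x∈ker (S'⊆S u∈S'))
      }

  cfvr-transfer : ∀ {S S'} → S' ⊆ S →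
    (∀ {v} → v ∈ S' → CoreOn S v → CoreOn S' v) →
    (∀ {v} → CoreOn S' v → CoreOn S v) →
    (∀ {u v} → u ∈ S → v ∈ S' → Adj T u v → CoreOn S u → u ∈ S') →
    ∀ {v} → v ∈ S' → CFVROn S v ⇔ CFVROn S' v
  cfvr-transfer S'⊆S restrict-core extend-core core-nbr-stays v∈S' = mk⇔
    (λ cf → record
      { member            = v∈S'
      ; not-core          = not-core cf ∘ extend-core
      ; no-core-neighbour = λ u∈S' u~v → no-core-neighbour cf (S'⊆S u∈S') u~v ∘ extend-core
      })
    (λ cf' → record
      { member            = S'⊆S v∈S'
      ; not-core          = not-core cf' ∘ restrict-core v∈S'
      ; no-core-neighbour = λ u∈S u~v u-core →
          let u∈S' = core-nbr-stays u∈S v∈S' u~v u-core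
          in no-core-neighbour cf' u∈S' u~v (restrict-core u∈S' u-core)
      })

  matching-cong : ∀ {P Q : Fin n → Set} → (∀ {v} → P v ⇔ Q v) →
    HasPerfectMatching Q → HasPerfectMatching P
  matching-cong P⇔Q (m , m-ok) = m , λ v Pv →
    let Qmv , v~mv , mmv≡v = m-ok v (to P⇔Q Pv) in from P⇔Q Qmv , v~mv , mmv≡v

  matching-add-edge : ∀ {P Q : Fin n → Set} {ℓ p} → Adj T ℓ p → P ℓ ⇔ P p →
    (∀ {v} → v ≢ ℓ → v ≢ p → P v ⇔ Q v) → (∀ {v} → Q v → v ≢ ℓ × v ≢ p) →
    HasPerfectMatching Q → HasPerfectMatching P
  matching-add-edge {P} {Q} {ℓ} {p} ℓ~p Pℓ⇔Pp P⇔Q Q-avoids (m , m-ok) = m⁺ , m⁺-ok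
    where
    m⁺ : Fin n → Fin n
    m⁺ v with v ≟ ℓ | v ≟ p
    ... | yes _ | _     = p
    ... | no _  | yes _ = ℓ
    ... | no _  | no _  = m v

    m⁺-ℓ : m⁺ ℓ ≡ p
    m⁺-ℓ with ℓ ≟ ℓ
    ... | yes _   = refl
    ... | no ℓ≢ℓ = ⊥-elim (ℓ≢ℓ refl)

    m⁺-p : m⁺ p ≡ ℓ
    m⁺-p with p ≟ ℓ | p ≟ p
    ... | yes p≡ℓ | _       = ⊥-elim (adj-irrefl ℓ~p (sym p≡ℓ))
    ... | no _    | yes _   = refl
    ... | no _    | no p≢p = ⊥-elim (p≢p refl)

    m⁺-other : ∀ {v} → v ≢ ℓ → v ≢ p → m⁺ v ≡ m v
    m⁺-other {v} v≢ℓ v≢p with v ≟ ℓ | v ≟ p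
    ... | yes v≡ℓ | _       = ⊥-elim (v≢ℓ v≡ℓ)
    ... | no _    | yes v≡p = ⊥-elim (v≢p v≡p)
    ... | no _    | no _    = refl

    m⁺-ok : ∀ v → P v → P (m⁺ v) × Adj T v (m⁺ v) × m⁺ (m⁺ v) ≡ v
    m⁺-ok v Pv = by-cases (v ≟ ℓ) (v ≟ p)
      where
      by-cases : Dec (v ≡ ℓ) → Dec (v ≡ p) → P (m⁺ v) × Adj T v (m⁺ v) × m⁺ (m⁺ v) ≡ v
      by-cases (yes refl) _ rewrite m⁺-ℓ | m⁺-p = to Pℓ⇔Pp Pv , ℓ~p , refl
      by-cases (no _) (yes refl) rewrite m⁺-p | m⁺-ℓ = from Pℓ⇔Pp Pv , adj-sym ℓ~p , refl
      by-cases (no v≢ℓ) (no v≢p)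
        with Qmv , v~mv , mmv≡v ← m-ok v (to (P⇔Q v≢ℓ v≢p) Pv)
        with mv≢ℓ , mv≢p ← Q-avoids Qmv
        rewrite m⁺-other v≢ℓ v≢p | m⁺-other mv≢ℓ mv≢p =
        from (P⇔Q mv≢ℓ mv≢p) Qmv , v~mv , mmv≡v

  Isolated : Subset n → Fin n → Set
  Isolated S ℓ = ∀ {y} → y ∈ S → ¬ Adj T ℓ y

  module IsolatedStep {S ℓ} (ℓ∈S : ℓ ∈ S) (isolated : Isolated S ℓ) where

    isolated-core : CoreOn S ℓ
    isolated-core = δ ℓ 1ℚ , δ∈ker , λ δℓ≡0 → 1≢0 (trans (sym (restrict-∈ (_≟ ℓ) (λ _ → 1ℚ) refl)) δℓ≡0)
      where
      1≢0 : 1ℚ ≢ 0ℚ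
      1≢0 ()
      δ∈ker : InKernelOn S (δ ℓ 1ℚ)
      δ∈ker = record
        { outside-zero = λ {v} v∉S → restrict-∉ (_≟ ℓ) _ {v} λ { refl → v∉S ℓ∈S }
        ; row-zero     = λ u∈S → trans (Ax-δ ℓ 1ℚ _) (A*≡0 λ u~ℓ → ⊥-elim (isolated u∈S (adj-sym u~ℓ)))
        }

    restrict-core : ∀ {v} → v ∈ S - ℓ → CoreOn S v → CoreOn (S - ℓ) v
    restrict-core = core-restrict x∈p-y⇒x∈p leaving-zero
      where
      leaving-zero : ∀ {x} → InKernelOn S x → ∀ {u v} → u ∈ S - ℓ → v ∉ S - ℓ → Adj T u v → x v ≡ 0ℚ
      leaving-zero x∈ker {u} {v} u∈S-ℓ v∉S-ℓ u~v with v ≟ ℓ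
      ... | yes refl = ⊥-elim (isolated (x∈p-y⇒x∈p u∈S-ℓ) (adj-sym u~v))
      ... | no v≢ℓ   = outside-zero x∈ker λ v∈S → v∉S-ℓ (x∈p∧x≢y⇒x∈p-y v∈S v≢ℓ)

    extend-core : ∀ {v} → CoreOn (S - ℓ) v → CoreOn S v
    extend-core (x , x∈ker , xv≢0) = x , x∈kerS , xv≢0
      where
      row : ∀ {u} → u ∈ S → Dec (u ≡ ℓ) → Ax x u ≡ 0ℚ
      row _   (yes refl) = Ax-zero λ y ℓ~y →
        outside-zero x∈ker λ y∈S-ℓ → isolated (x∈p-y⇒x∈p y∈S-ℓ) ℓ~y
      row u∈S (no u≢ℓ)   = row-zero x∈ker (x∈p∧x≢y⇒x∈p-y u∈S u≢ℓ)
      x∈kerS : InKernelOn S x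
      x∈kerS = record
        { outside-zero = λ v∉S → outside-zero x∈ker (v∉S ∘ x∈p-y⇒x∈p)
        ; row-zero     = λ u∈S → row u∈S (_ ≟ ℓ)
        }

    cfvr-remove-isolated : ∀ {v} → CFVROn S v ⇔ CFVROn (S - ℓ) v
    cfvr-remove-isolated =
      mk⇔ (λ cf → to (transfer (∈S-ℓ cf)) cf) (λ cf' → from (transfer (member cf')) cf')
      where
      ∈S-ℓ : ∀ {v} → CFVROn S v → v ∈ S - ℓ
      ∈S-ℓ cf = x∈p∧x≢y⇒x∈p-y (member cf) λ { refl → not-core cf isolated-core }
      core-neighbour-stays : ∀ {u v} → u ∈ S → v ∈ S - ℓ → Adj T u v → CoreOn S u → u ∈ S - ℓ
      core-neighbour-stays u∈S v∈S-ℓ u~v _ =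
        x∈p∧x≢y⇒x∈p-y u∈S λ { refl → isolated (x∈p-y⇒x∈p v∈S-ℓ) u~v }
      transfer : ∀ {v} → v ∈ S - ℓ → CFVROn S v ⇔ CFVROn (S - ℓ) v
      transfer = cfvr-transfer x∈p-y⇒x∈p restrict-core extend-core core-neighbour-stays

  record Pendant (S : Subset n) (ℓ p : Fin n) : Set where
    field
      leaf∈S         : ℓ ∈ S
      support∈S      : p ∈ S
      leaf~support   : Adj T ℓ p
      only-neighbour : ∀ {y} → y ∈ S → Adj T ℓ y → y ≡ p

  module Paths (tree : IsTree T) where

    open DecMembership (_≟_ {n}) using () renaming (_∈?_ to _∈ₗ?_)

    path : Fin n → Fin n → List (Fin n)
    path u v = proj₁ (tree u v)

    path-walk : ∀ u v → Walk T u v (path u v)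
    path-walk u v = proj₁ (proj₁ (proj₂ (tree u v)))

    path-distinct : ∀ u v → Unique (path u v)
    path-distinct u v = proj₂ (proj₁ (proj₂ (tree u v)))

    path-unique : ∀ {u v q} → Walk T u v q → Unique q → q ≡ path u v
    path-unique {u} {v} w q-distinct = proj₂ (proj₂ (tree u v)) _ (w , q-distinct)

    path-starts : ∀ u v → ∃ λ t → path u v ≡ u ∷ t
    path-starts u v = walk-starts (path-walk u v)

    path-≡⇒≡ : ∀ {u u' r} → path u r ≡ path u' r → u ≡ u'
    path-≡⇒≡ {u} {u'} {r} e with t , eu ← path-starts u r | t' , eu' ← path-starts u' r =
      ∷-injectiveˡ (trans (sym eu) (trans e eu'))

    ∈-path-start : ∀ u v → u ∈ₗ path u v
    ∈-path-start u v with t , e ← path-starts u v rewrite e = here refl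

    path-adj : ∀ {v p} → Adj T v p → path v p ≡ v ∷ p ∷ []
    path-adj v~p = sym (path-unique (step v~p here) ((adj-irrefl v~p ∷ []) ∷ [] ∷ []))

    ∈-path-adj : ∀ {v p w} → Adj T v p → w ∈ₗ path v p → w ≡ v ⊎ w ≡ p
    ∈-path-adj v~p w∈ rewrite path-adj v~p with w∈
    ... | here w≡v         = inj₁ w≡v
    ... | there (here w≡p) = inj₂ w≡p

    path-∷ : ∀ {y b p} → Adj T y b → y ∉ₗ path b p → path y p ≡ y ∷ path b p
    path-∷ {b = b} {p} y~b y∉ =
      sym (path-unique (step y~b (path-walk b p)) (¬Any⇒All¬ _ y∉ ∷ path-distinct b p))

    path-suffix : ∀ {y b p} → y ∈ₗ path b p → ∃ λ pre → path b p ≡ pre ++ path y p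
    path-suffix {y} {b} {p} y∈ with pre , q , e , w ← walk-from (path-walk b p) y∈ =
      pre , trans e (cong (pre ++_) (path-unique w (Unique-++⁻ʳ pre (subst Unique e (path-distinct b p)))))

    -- A neighbour w of p on the path from b is the vertex just before p, so it is
    -- also on the path from any other neighbour y ≠ p of b.
    ∈-path-neighbour : ∀ {w p b y} → Adj T w p → w ∈ₗ path b p → Adj T y b → y ≢ p → w ∈ₗ path y p
    ∈-path-neighbour {w} {p} {b} {y} w~p w∈ y~b y≢p with y ∈ₗ? path b p
    ... | no y∉ = subst (w ∈ₗ_) (sym (path-∷ y~b y∉)) (there w∈)
    ... | yes y∈ with path-suffix {p = p} y∈ | path-suffix {p = p} w∈ | path-starts y p
    ...   | _   , _  | _    , _   | []    , ey = ⊥-elim (y≢p (walk-trivial (subst (Walk T y p) ey (path-walk y p))))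
    ...   | pre , eb | pre₂ , eb₂ | _ ∷ _ , ey = subst (w ∈ₗ_) (sym ey) (penultimate-∈ pre pre₂
            (trans (sym (trans eb (cong (pre ++_) ey))) (trans eb₂ (cong (pre₂ ++_) (path-adj w~p)))))

    depth : Fin n → Fin n → ℕ
    depth r y = length (path y r)

    deeper-neighbour-path : ∀ {r ℓ y} → depth r y ≤ depth r ℓ → Adj T ℓ y → path ℓ r ≡ ℓ ∷ path y r
    deeper-neighbour-path {r} {ℓ} {y} y≤ℓ ℓ~y with ℓ ∈ₗ? path y r
    ... | no ℓ∉ = path-∷ ℓ~y ℓ∉
    ... | yes ℓ∈ with path-suffix {p = r} ℓ∈
    ...   | []      , e = ⊥-elim (adj-irrefl ℓ~y (sym (path-≡⇒≡ e)))
    ...   | _ ∷ pre , e = ⊥-elim (<-irrefl refl (<-≤-trans ℓ<y y≤ℓ))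
      where
      ℓ<y : depth r ℓ < depth r y
      ℓ<y = subst (depth r ℓ <_) (sym (trans (cong length e) (cong suc (length-++ pre))))
                  (s≤s (m≤n+m (depth r ℓ) (length pre)))

    shallower-neighbour-unique : ∀ {r ℓ y y'} → depth r y ≤ depth r ℓ → depth r y' ≤ depth r ℓ →
      Adj T ℓ y → Adj T ℓ y' → y ≡ y'
    shallower-neighbour-unique y≤ℓ y'≤ℓ ℓ~y ℓ~y' = path-≡⇒≡ (∷-injectiveʳ
      (trans (sym (deeper-neighbour-path y≤ℓ ℓ~y)) (deeper-neighbour-path y'≤ℓ ℓ~y')))

    Branch : Fin n → Fin n → Fin n → Set
    Branch p w y = w ∈ₗ path y p

    branch? : ∀ p w → Decidable (Branch p w)
    branch? p w y = w ∈ₗ? path y p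

    branch-row : ∀ {S x p w u} → Adj T w p → InKernelOn S x → x p ≡ 0ℚ → u ∈ S → u ≢ p →
      Ax (restrict (branch? p w) x) u ≡ 0ℚ
    branch-row {S} {x} {p} {w} {u} w~p x∈ker xp≡0 u∈S u≢p with branch? p w u
    ... | yes u∈B = trans (Ax-cong agree) (row-zero x∈ker u∈S)
      where
      agree : ∀ v → Adj T u v → restrict (branch? p w) x v ≡ x v
      agree v u~v with branch? p w v | v ≟ p
      ... | yes _   | _        = refl
      ... | no _    | yes refl = sym xp≡0
      ... | no v∉B  | no v≢p   = ⊥-elim (v∉B (∈-path-neighbour w~p u∈B (adj-sym u~v) v≢p))
    ... | no u∉B = Ax-zero λ v u~v → restrict-∉ (branch? p w) x
            λ v∈B → u∉B (∈-path-neighbour w~p v∈B u~v u≢p)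

    branch-row-at-root : ∀ {x p w} → Adj T w p → Ax (restrict (branch? p w) x) p ≡ x w
    branch-row-at-root {x} {p} {w} w~p =
      trans (Ax-single w outside-branch)
            (trans (A*-adjacent _ (adj-sym w~p)) (restrict-∈ (branch? p w) x (∈-path-start w p)))
      where
      outside-branch : ∀ v → Adj T p v → v ≢ w → restrict (branch? p w) x v ≡ 0ℚ
      outside-branch v p~v v≢w = restrict-∉ (branch? p w) x λ w∈ → case (∈-path-adj (adj-sym p~v) w∈)
        where
        case : w ≡ v ⊎ w ≡ p → ⊥
        case (inj₁ w≡v) = v≢w (sym w≡v)
        case (inj₂ w≡p) = adj-irrefl w~p w≡p

  module PendantStep {S ℓ p} (pendant : Pendant S ℓ p) where

    open Pendant pendant

    S' : Subset n
    S' = S - ℓ - p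

    support≢leaf : p ≢ ℓ
    support≢leaf p≡ℓ = adj-irrefl leaf~support (sym p≡ℓ)

    S'⊆S : S' ⊆ S
    S'⊆S = x∈p-y⇒x∈p ∘ x∈p-y⇒x∈p

    ∈S' : ∀ {v} → v ∈ S → v ≢ ℓ → v ≢ p → v ∈ S'
    ∈S' v∈S v≢ℓ v≢p = x∈p∧x≢y⇒x∈p-y (x∈p∧x≢y⇒x∈p-y v∈S v≢ℓ) v≢p

    S'-avoids : ∀ {v} → v ∈ S' → v ≢ ℓ × v ≢ p
    S'-avoids v∈S' = x∈p-y⇒x≢y (x∈p-y⇒x∈p v∈S') , x∈p-y⇒x≢y v∈S'

    leaf-neighbour : ∀ {u} → u ∈ S → Adj T u ℓ → u ≡ p
    leaf-neighbour u∈S u~ℓ = only-neighbour u∈S (adj-sym u~ℓ)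

    kernel-zero-at-support : ∀ {x} → InKernelOn S x → x p ≡ 0ℚ
    kernel-zero-at-support {x} x∈ker = begin
      x p           ≡⟨ sym (A*-adjacent (x p) leaf~support) ⟩
      A T ℓ p * x p ≡⟨ sym (Ax-single p others-zero) ⟩
      Ax x ℓ        ≡⟨ row-zero x∈ker leaf∈S ⟩
      0ℚ            ∎
      where
      open ≡-Reasoning
      others-zero : ∀ v → Adj T ℓ v → v ≢ p → x v ≡ 0ℚ
      others-zero v ℓ~v v≢p with v ∈? S
      ... | yes v∈S = ⊥-elim (v≢p (only-neighbour v∈S ℓ~v))
      ... | no v∉S  = outside-zero x∈ker v∉S

    support-not-core : ¬ CoreOn S p
    support-not-core (x , x∈ker , xp≢0) = xp≢0 (kernel-zero-at-support x∈ker)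

    restrict-core : ∀ {v} → v ∈ S' → CoreOn S v → CoreOn S' v
    restrict-core = core-restrict S'⊆S leaving-zero
      where
      leaving-zero : ∀ {x} → InKernelOn S x → ∀ {u v} → u ∈ S' → v ∉ S' → Adj T u v → x v ≡ 0ℚ
      leaving-zero x∈ker {u} {v} u∈S' v∉S' u~v with v ≟ ℓ | v ≟ p
      ... | yes refl | _        = ⊥-elim (proj₂ (S'-avoids u∈S') (leaf-neighbour (S'⊆S u∈S') u~v))
      ... | no _     | yes refl = kernel-zero-at-support x∈ker
      ... | no v≢ℓ   | no v≢p   = outside-zero x∈ker λ v∈S → v∉S' (∈S' v∈S v≢ℓ v≢p)

    extend-core : ∀ {v} → CoreOn S' v → CoreOn S v
    extend-core {v} (x' , x'∈ker , x'v≢0) = x , x∈ker , xv≢0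
      where
      c : ℚ
      c = - Ax x' p
      x : Fin n → ℚ
      x y = x' y + δ ℓ c y

      Ax-x : ∀ u → Ax x u ≡ Ax x' u + A T u ℓ * c
      Ax-x u = trans (Ax-+ x' (δ ℓ c) u) (cong (Ax x' u +_) (Ax-δ ℓ c u))

      x'-zero-near-leaf : ∀ y → Adj T ℓ y → x' y ≡ 0ℚ
      x'-zero-near-leaf y ℓ~y = outside-zero x'∈ker λ y∈S' →
        proj₂ (S'-avoids y∈S') (only-neighbour (S'⊆S y∈S') ℓ~y)

      row : ∀ {u} → u ∈ S → Dec (u ≡ ℓ) → Dec (u ≡ p) → Ax x u ≡ 0ℚ
      row _ (yes refl) _ = trans (Ax-x ℓ) (trans
        (cong₂ _+_ (Ax-zero x'-zero-near-leaf) (A*≡0 λ ℓ~ℓ → ⊥-elim (adj-irrefl ℓ~ℓ refl)))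
        (+-identityˡ 0ℚ))
      row _ (no _) (yes refl) = trans (Ax-x p) (trans
        (cong (Ax x' p +_) (A*-adjacent c (adj-sym leaf~support)))
        (+-inverseʳ (Ax x' p)))
      row u∈S (no u≢ℓ) (no u≢p) = trans (Ax-x _) (trans
        (cong₂ _+_ (row-zero x'∈ker (∈S' u∈S u≢ℓ u≢p)) (A*≡0 λ u~ℓ → ⊥-elim (u≢p (leaf-neighbour u∈S u~ℓ))))
        (+-identityˡ 0ℚ))

      x∈ker : InKernelOn S x
      x∈ker = record
        { outside-zero = λ {y} y∉S → trans
            (cong₂ _+_ (outside-zero x'∈ker (y∉S ∘ S'⊆S)) (restrict-∉ (_≟ ℓ) _ {y} λ { refl → y∉S leaf∈S }))
            (+-identityˡ 0ℚ)
        ; row-zero     = λ u∈S → row u∈S (_ ≟ ℓ) (_ ≟ p)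
        }

      xv≢0 : x v ≢ 0ℚ
      xv≢0 xv≡0 = x'v≢0 (trans (sym (trans (cong (x' v +_) (restrict-∉ (_≟ ℓ) _ v≢ℓ)) (+-identityʳ (x' v)))) xv≡0)
        where
        v≢ℓ : v ≢ ℓ
        v≢ℓ = proj₁ (S'-avoids (core-∈ (x' , x'∈ker , x'v≢0)))

    cfvr-remove-pendant : ∀ {v} → v ≢ ℓ → v ≢ p → CFVROn S v ⇔ CFVROn S' v
    cfvr-remove-pendant v≢ℓ v≢p =
      mk⇔ (λ cf → to (transfer (∈S' (member cf) v≢ℓ v≢p)) cf) (λ cf' → from (transfer (member cf')) cf')
      where
      core-neighbour-stays : ∀ {u w} → u ∈ S → w ∈ S' → Adj T u w → CoreOn S u → u ∈ S'
      core-neighbour-stays u∈S w∈S' u~w u-core = ∈S' u∈S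
        (λ { refl → proj₂ (S'-avoids w∈S') (only-neighbour (S'⊆S w∈S') u~w) })
        (λ { refl → support-not-core u-core })
      transfer : ∀ {w} → w ∈ S' → CFVROn S w ⇔ CFVROn S' w
      transfer = cfvr-transfer S'⊆S restrict-core extend-core core-neighbour-stays

    cfvr-support⇒leaf : CFVROn S p → CFVROn S ℓ
    cfvr-support⇒leaf cf = record
      { member            = leaf∈S
      ; not-core          = no-core-neighbour cf leaf∈S leaf~support
      ; no-core-neighbour = λ u∈S u~ℓ →
          subst (λ u → ¬ CoreOn S u) (sym (leaf-neighbour u∈S u~ℓ)) support-not-core
      }

    module _ (tree : IsTree T) where

      open Paths tree

      leaf-core : ∀ {w} → w ∈ S → Adj T w p → w ≢ ℓ → CoreOn S w → CoreOn S ℓ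
      leaf-core {w} w∈S w~p w≢ℓ (x , x∈ker , xw≢0) = z , z∈ker , zℓ≢0
        where
        r : Fin n → ℚ
        r = restrict (branch? p w) x
        z : Fin n → ℚ
        z y = δ ℓ (- x w) y + r y

        Ax-z : ∀ u → Ax z u ≡ A T u ℓ * (- x w) + Ax r u
        Ax-z u = trans (Ax-+ (δ ℓ (- x w)) r u) (cong (_+ Ax r u) (Ax-δ ℓ (- x w) u))

        row : ∀ {u} → u ∈ S → Dec (u ≡ p) → Ax z u ≡ 0ℚ
        row _ (yes refl) = trans (Ax-z p) (trans
          (cong₂ _+_ (A*-adjacent _ (adj-sym leaf~support)) (branch-row-at-root w~p))
          (+-inverseˡ (x w)))
        row u∈S (no u≢p) = trans (Ax-z _) (trans
          (cong₂ _+_ (A*≡0 λ u~ℓ → ⊥-elim (u≢p (leaf-neighbour u∈S u~ℓ)))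
                     (branch-row w~p x∈ker (kernel-zero-at-support x∈ker) u∈S u≢p))
          (+-identityˡ 0ℚ))

        z∈ker : InKernelOn S z
        z∈ker = record
          { outside-zero = λ {y} y∉S → trans
              (cong₂ _+_ (restrict-∉ (_≟ ℓ) _ {y} λ { refl → y∉S leaf∈S })
                         (restrict-zero (branch? p w) x (outside-zero x∈ker y∉S)))
              (+-identityˡ 0ℚ)
          ; row-zero     = λ u∈S → row u∈S (_ ≟ p)
          }

        ℓ∉branch : ¬ Branch p w ℓ
        ℓ∉branch w∈ with ∈-path-adj leaf~support w∈
        ... | inj₁ w≡ℓ = w≢ℓ w≡ℓ
        ... | inj₂ w≡p = adj-irrefl w~p w≡p

        zℓ≡-xw : z ℓ ≡ - x w
        zℓ≡-xw = trans (cong₂ _+_ (restrict-∈ (_≟ ℓ) _ refl) (restrict-∉ (branch? p w) x ℓ∉branch))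
                       (+-identityʳ (- x w))

        zℓ≢0 : z ℓ ≢ 0ℚ
        zℓ≢0 zℓ≡0 = xw≢0 (neg-injective (trans (sym zℓ≡-xw) zℓ≡0))

      cfvr-leaf⇔support : CFVROn S ℓ ⇔ CFVROn S p
      cfvr-leaf⇔support = mk⇔ leaf⇒support cfvr-support⇒leaf
        where
        leaf⇒support : CFVROn S ℓ → CFVROn S p
        leaf⇒support cf = record
          { member            = support∈S
          ; not-core          = support-not-core
          ; no-core-neighbour = λ {u} u∈S u~p u-core → not-core cf (ℓ-core u∈S u~p u-core (u ≟ ℓ))
          }
          where
          ℓ-core : ∀ {u} → u ∈ S → Adj T u p → CoreOn S u → Dec (u ≡ ℓ) → CoreOn S ℓ
          ℓ-core _   _   u-core (yes refl) = u-core
          ℓ-core u∈S u~p u-core (no u≢ℓ)   = leaf-core u∈S u~p u≢ℓ u-core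

      matching-extend : HasPerfectMatching (CFVROn S') → HasPerfectMatching (CFVROn S)
      matching-extend =
        matching-add-edge leaf~support cfvr-leaf⇔support cfvr-remove-pendant (S'-avoids ∘ member)

  module _ (tree : IsTree T) where

    open Paths tree

    low-degree-vertex : ∀ S → Empty S ⊎ ∃ λ ℓ → (ℓ ∈ S × Isolated S ℓ) ⊎ ∃ (Pendant S ℓ)
    low-degree-vertex S with nonempty? S
    ... | no empty = inj₁ empty
    ... | yes (r , _) with deepest (depth r) S
    ...   | inj₁ empty = inj₁ empty
    ...   | inj₂ (ℓ , ℓ∈S , ℓ-deepest) with any? (λ y → (y ∈? S) ×-dec adj? ℓ y)
    ...     | no no-neighbour = inj₂ (ℓ , inj₁ (ℓ∈S , λ y∈S ℓ~y → no-neighbour (_ , y∈S , ℓ~y)))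
    ...     | yes (p , p∈S , ℓ~p) = inj₂ (ℓ , inj₂ (p , record
      { leaf∈S         = ℓ∈S
      ; support∈S      = p∈S
      ; leaf~support   = ℓ~p
      ; only-neighbour = λ y∈S ℓ~y →
          shallower-neighbour-unique (ℓ-deepest y∈S) (ℓ-deepest p∈S) ℓ~y ℓ~p
      }))

    matching-on : ∀ S → Acc _⊂_ S → HasPerfectMatching (CFVROn S)
    matching-on S (acc smaller) with low-degree-vertex S
    ... | inj₁ empty = (λ v → v) , λ v cf → ⊥-elim (empty (v , member cf))
    ... | inj₂ (ℓ , inj₁ (ℓ∈S , isolated)) =
      matching-cong (IsolatedStep.cfvr-remove-isolated ℓ∈S isolated)
        (matching-on (S - ℓ) (smaller (x∈p⇒p-x⊂p ℓ∈S)))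
    ... | inj₂ (ℓ , inj₂ (p , pendant)) =
      PendantStep.matching-extend pendant tree
        (matching-on (S - ℓ - p) (smaller (⊂-trans (x∈p⇒p-x⊂p p∈S-ℓ) (x∈p⇒p-x⊂p leaf∈S))))
      where
      open Pendant pendant
      p∈S-ℓ : p ∈ S - ℓ
      p∈S-ℓ = x∈p∧x≢y⇒x∈p-y support∈S (PendantStep.support≢leaf pendant)

  cfvr-⊤ : ∀ {v} → CFVR T v ⇔ CFVROn ⊤ v
  cfvr-⊤ = mk⇔
    (λ (not-core-v , no-core-nbr) → record
      { member            = ∈⊤
      ; not-core          = not-core-v ∘ core-from-⊤
      ; no-core-neighbour = λ _ u~v u-core → no-core-nbr (_ , u~v , core-from-⊤ u-core)
      })
    (λ cf → not-core cf ∘ core-to-⊤ , λ (u , u~v , u-core) → no-core-neighbour cf ∈⊤ u~v (core-to-⊤ u-core))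
    where
    core-to-⊤ : ∀ {v} → CoreVertex T v → CoreOn ⊤ v
    core-to-⊤ (x , x∈ker , xv≢0) =
      x , record { outside-zero = λ v∉⊤ → ⊥-elim (v∉⊤ ∈⊤) ; row-zero = λ _ → x∈ker _ } , xv≢0
    core-from-⊤ : ∀ {v} → CoreOn ⊤ v → CoreVertex T v
    core-from-⊤ (x , x∈ker , xv≢0) = x , (λ u → row-zero x∈ker ∈⊤) , xv≢0

mainTheorem13 : (n : ℕ) (T : Graph n) → IsTree T → Singular T →
    HasPerfectMatchingInduced T (CFVR T)
mainTheorem13 n T tree _ = matching-cong T (cfvr-⊤ T) (matching-on T tree ⊤ (⊂-wellFounded ⊤))
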